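{- For $n\geq1$ let $a_n=n!\sum_{i=1}^{n-1}\frac{1}{i!}$. For a finite sequence of integer pairs $(n_1,\alpha_1),\dots,(n_p,\alpha_p)$ with $p\geq1$, $n_i\geq2$ and $\alpha_i\geq1$, define recursively $$f\big((n_1,\alpha_1),\dots,(n_p,\alpha_p)\big)=\begin{cases}\alpha_1a_{n_1}&\text{if }p=1,\\ \alpha_1\big[a_{n_1}+n_1!\,f\big((n_2,\alpha_2),\dots,(n_p,\alpha_p)\big)\big]&\text{otherwise.}\end{cases}$$ Let $p\geq2$, let $(n_i,\alpha_i)$, $3\leq i\leq p$, be integer pairs with $n_i\geq2$, $\alpha_i\geq1$, and let $m,n,\alpha,\beta$ be integers with $m>n\geq2$ and $\alpha,\beta\geq1$. Set $$\Delta f=f\big((m,\alpha),(n,\beta),(n_3,\alpha_3),\dots,(n_p,\alpha_p)\big)-f\big((n,\beta),(m,\alpha),(n_3,\alpha_3),\dots,(n_p,\alpha_p)\big).$$ Then: if $\beta\geq2$, $\Delta f<0$; if $\beta=1$, $\Delta f>0$. -}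

module Defs where

open import Data.Nat using (ℕ; zero; suc; _+_; _*_; _!; _/_; _≤_)
open import Data.Nat.Properties using (_!≢0)
open import Data.List using (List; []; _∷_; map; drop; upTo)
open import Data.Nat.ListAction using (sum)
open import Data.Product using (_×_; _,_)

_!/_! : ℕ → ℕ → ℕ
n !/ i ! = _/_ (n !) (i !) {{i !≢0}}

-- a n = n! * Σ_{i=1}^{n-1} 1/i!  =  Σ_{i=1}^{n-1} n!/i!   (each term an integer)
a : ℕ → ℕ
a n = sum (map (λ i → n !/ i !) (drop 1 (upTo n)))

f : ℕ × ℕ → List (ℕ × ℕ) → ℕ
f (n₁ , α₁) [] = α₁ * a n₁
f (n₁ , α₁) (q ∷ qs) = α₁ * (a n₁ + n₁ ! * f q qs)

ValidPair : ℕ × ℕ → Set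
ValidPair (n , α) = (2 ≤ n) × (1 ≤ α)

-- Write eₖ = aₖ / k! = Σ_{i<k} 1/i!. In the difference of the two values of f the tail
-- contributes α β m! n! f(rest) to both and cancels, leaving
--   α aₘ + α β m! aₙ − β aₙ − α β n! aₘ.
-- Since (aₙ + 1)/n! = eₙ₊₁ ≤ eₘ we have m!(aₙ + 1) ≤ n! aₘ, and eₘ ≤ 2 − 2/m! reads
-- aₘ + 2 ≤ 2 m!; together they make the difference negative as soon as β ≥ 2. For β = 1 it
-- suffices that Dₘ = aₘ + m! aₙ − n! aₘ − aₙ is positive, and the recurrence
-- aₘ₊₁ = (m + 1)(aₘ + 1) gives Dₙ = 0 and Dₘ₊₁ > (m + 1) Dₘ.
module Submission where

open import Defs
open import Data.Nat using (ℕ; suc; _+_; _*_; _!; _≤_; _<_; _>_; _≤′_; ≤′-refl; ≤′-step; z≤n; s≤s; NonZero; >-nonZero)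
open import Data.Nat.Properties
open import Data.Nat.DivMod using (*-/-assoc; m*n/n≡m)
open import Data.Nat.Divisibility using (m≤n⇒m!∣n!)
open import Data.Nat.ListAction using (sum)
open import Data.Nat.ListAction.Properties using (sum-++)
open import Data.Nat.Tactic.RingSolver using (solve-∀)
open import Data.List using (List; []; _∷_; map; drop; upTo; _∷ʳ_)
open import Data.List.Properties using (upTo-∷ʳ; map-++)
open import Data.List.Relation.Unary.All as All using (All; []; _∷_)
open import Data.List.Relation.Unary.All.Properties using (drop⁺; all-upTo)
open import Data.Product using (_×_; _,_)
open import Relation.Binary.PropositionalEquality using (_≡_; refl; sym; cong; cong₂; module ≡-Reasoning)

sum-!/-suc : ∀ m {is : List ℕ} → All (_≤ m) is →
             sum (map (λ i → suc m !/ i !) is) ≡ suc m * sum (map (λ i → m !/ i !) is)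
sum-!/-suc m [] = sym (*-zeroʳ (suc m))
sum-!/-suc m {i ∷ is} (i≤m ∷ is≤m) = begin
  suc m !/ i ! + sum (map (λ i → suc m !/ i !) is)
    ≡⟨ cong₂ _+_ (*-/-assoc (suc m) {{i !≢0}} (m≤n⇒m!∣n! i≤m)) (sum-!/-suc m is≤m) ⟩
  suc m * (m !/ i !) + suc m * sum (map (λ i → m !/ i !) is)
    ≡⟨ *-distribˡ-+ (suc m) (m !/ i !) (sum (map (λ i → m !/ i !) is)) ⟨
  suc m * sum (map (λ i → m !/ i !) (i ∷ is)) ∎
  where open ≡-Reasoning

-- a 1 = 0, so the recurrence fails at m = 0.
a-suc : ∀ m .{{_ : NonZero m}} → a (suc m) ≡ suc m * (a m + 1)
a-suc m@(suc _) = begin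
  a (suc m)                                 ≡⟨ cong (λ is → sum (map F (drop 1 is))) (upTo-∷ʳ m) ⟨
  sum (map F (drop 1 (upTo m) ∷ʳ m))        ≡⟨ cong sum (map-++ F (drop 1 (upTo m)) (m ∷ [])) ⟩
  sum (map F (drop 1 (upTo m)) ∷ʳ F m)      ≡⟨ sum-++ (map F (drop 1 (upTo m))) (F m ∷ []) ⟩
  sum (map F (drop 1 (upTo m))) + (F m + 0)
    ≡⟨ cong₂ _+_ (sum-!/-suc m indices≤m) (cong (_+ 0) (m*n/n≡m (suc m) (m !) {{m !≢0}})) ⟩
  suc m * a m + (suc m + 0)                 ≡⟨ distrib (suc m) (a m) ⟩
  suc m * (a m + 1)                         ∎
  where
  open ≡-Reasoning
  F : ℕ → ℕ
  F i = suc m !/ i !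
  indices≤m : All (_≤ m) (drop 1 (upTo m))
  indices≤m = All.map <⇒≤ (drop⁺ 1 (all-upTo m))
  distrib : ∀ x y → x * y + (x + 0) ≡ x * (y + 1)
  distrib = solve-∀

private
  nonZero-≤ : ∀ {n m} → 1 ≤ n → n ≤ m → NonZero m
  nonZero-≤ 1≤n n≤m = >-nonZero (≤-trans 1≤n n≤m)

m!*[aₙ+1]≤n!*aₘ₊₁ : ∀ {m n} .{{_ : NonZero m}} → m ! * (a n + 1) ≤ n ! * (a m + 1) →
                    suc m ! * (a n + 1) ≤ n ! * a (suc m)
m!*[aₙ+1]≤n!*aₘ₊₁ {m} {n} le = begin
  suc m * m ! * (a n + 1)     ≡⟨ *-assoc (suc m) (m !) (a n + 1) ⟩
  suc m * (m ! * (a n + 1))   ≤⟨ *-monoʳ-≤ (suc m) le ⟩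
  suc m * (n ! * (a m + 1))   ≡⟨ swap (suc m) (n !) (a m + 1) ⟩
  n ! * (suc m * (a m + 1))   ≡⟨ cong (n ! *_) (a-suc m) ⟨
  n ! * a (suc m)             ∎
  where
  open ≤-Reasoning
  swap : ∀ x y z → x * (y * z) ≡ y * (x * z)
  swap = solve-∀

n≤m⇒m!*[aₙ+1]≤n!*[aₘ+1] : ∀ {m n} → 1 ≤ n → n ≤ m → m ! * (a n + 1) ≤ n ! * (a m + 1)
n≤m⇒m!*[aₙ+1]≤n!*[aₘ+1] {n = n} 1≤n n≤m = go (≤⇒≤′ n≤m)
  where
  go : ∀ {m} → n ≤′ m → m ! * (a n + 1) ≤ n ! * (a m + 1)
  go ≤′-refl = ≤-refl
  go (≤′-step n≤′m) = ≤-trans (m!*[aₙ+1]≤n!*aₘ₊₁ {n = n} {{nonZero-≤ 1≤n (≤′⇒≤ n≤′m)}} (go n≤′m))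
                              (*-monoʳ-≤ (n !) (m≤m+n _ 1))

n<m⇒m!*[aₙ+1]≤n!*aₘ : ∀ {m n} → 1 ≤ n → n < m → m ! * (a n + 1) ≤ n ! * a m
n<m⇒m!*[aₙ+1]≤n!*aₘ {n = n} 1≤n (s≤s n≤m) =
  m!*[aₙ+1]≤n!*aₘ₊₁ {n = n} {{nonZero-≤ 1≤n n≤m}} (n≤m⇒m!*[aₙ+1]≤n!*[aₘ+1] 1≤n n≤m)

-- a 2 + 1 reduces to 3.
n!*3≤2*[aₙ+1] : ∀ {n} → 2 ≤ n → n ! * 3 ≤ 2 * (a n + 1)
n!*3≤2*[aₙ+1] = n≤m⇒m!*[aₙ+1]≤n!*[aₘ+1] {n = 2} (s≤s z≤n)

[1+m]*n!≤m*[aₙ+1] : ∀ {m n} → 2 ≤ m → 2 ≤ n → suc m * n ! ≤ m * (a n + 1)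
[1+m]*n!≤m*[aₙ+1] {m} {n} 2≤m 2≤n = *-cancelˡ-≤ 2 (begin
  2 * (suc m * n !)       ≡⟨ e₁ m (n !) ⟩
  (2 + 2 * m) * n !       ≤⟨ *-monoˡ-≤ (n !) (+-monoˡ-≤ (2 * m) 2≤m) ⟩
  (m + 2 * m) * n !       ≡⟨ e₂ m (n !) ⟩
  m * (n ! * 3)           ≤⟨ *-monoʳ-≤ m (n!*3≤2*[aₙ+1] 2≤n) ⟩
  m * (2 * (a n + 1))     ≡⟨ e₃ m (a n + 1) ⟩
  2 * (m * (a n + 1))     ∎)
  where
  open ≤-Reasoning
  e₁ : ∀ x y → 2 * (suc x * y) ≡ (2 + 2 * x) * y
  e₁ = solve-∀
  e₂ : ∀ x y → (x + 2 * x) * y ≡ x * (y * 3)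
  e₂ = solve-∀
  e₃ : ∀ x y → x * (2 * y) ≡ 2 * (x * y)
  e₃ = solve-∀

aₘ+2≤2*m! : ∀ {m} → 2 ≤ m → a m + 2 ≤ 2 * m !
aₘ+2≤2*m! {2} _ = ≤-refl
aₘ+2≤2*m! {1} (s≤s ())
aₘ+2≤2*m! {suc m@(suc (suc _))} _ = begin
  a (suc m) + 2               ≡⟨ cong (_+ 2) (a-suc m) ⟩
  suc m * (a m + 1) + 2       ≤⟨ +-monoʳ-≤ (suc m * (a m + 1)) (s≤s (s≤s z≤n)) ⟩
  suc m * (a m + 1) + suc m   ≡⟨ e₁ m (a m) ⟩
  suc m * (a m + 2)           ≤⟨ *-monoʳ-≤ (suc m) (aₘ+2≤2*m! {m} (s≤s (s≤s z≤n))) ⟩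
  suc m * (2 * m !)           ≡⟨ e₂ (suc m) (m !) ⟩
  2 * (suc m * m !)           ∎
  where
  open ≤-Reasoning
  e₁ : ∀ x y → suc x * (y + 1) + suc x ≡ suc x * (y + 2)
  e₁ = solve-∀
  e₂ : ∀ x y → x * (2 * y) ≡ 2 * (x * y)
  e₂ = solve-∀

n!*aₘ₊₁+aₙ<aₘ₊₁+m!*aₙ : ∀ {m n} → 2 ≤ n → n ≤ m → n ! * a m + a n ≤ a m + m ! * a n →
                        n ! * a (suc m) + a n < a (suc m) + suc m ! * a n
n!*aₘ₊₁+aₙ<aₘ₊₁+m!*aₙ {m} {n} 2≤n n≤m le = begin
  suc (n ! * a (suc m) + a n)                    ≡⟨ cong (λ x → suc (n ! * x + a n)) (a-suc m) ⟩
  suc (n ! * (suc m * (a m + 1)) + a n)          ≡⟨ e₁ m (n !) (a m) (a n) ⟩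
  suc m * (n ! * a m) + suc m * n ! + (a n + 1)
    ≤⟨ +-monoˡ-≤ (a n + 1) (+-monoʳ-≤ (suc m * (n ! * a m)) ([1+m]*n!≤m*[aₙ+1] (≤-trans 2≤n n≤m) 2≤n)) ⟩
  suc m * (n ! * a m) + m * (a n + 1) + (a n + 1) ≡⟨ e₂ m (n !) (a m) (a n) ⟩
  suc m * (n ! * a m + a n) + suc m              ≤⟨ +-monoˡ-≤ (suc m) (*-monoʳ-≤ (suc m) le) ⟩
  suc m * (a m + m ! * a n) + suc m              ≡⟨ e₃ m (m !) (a m) (a n) ⟩
  suc m * (a m + 1) + suc m * m ! * a n          ≡⟨ cong (λ x → x + suc m ! * a n) (a-suc m) ⟨
  a (suc m) + suc m ! * a n                      ∎
  where
  instance
    _ : NonZero m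
    _ = nonZero-≤ (≤-trans (s≤s z≤n) 2≤n) n≤m
  open ≤-Reasoning
  e₁ : ∀ x N A B → suc (N * (suc x * (A + 1)) + B) ≡ suc x * (N * A) + suc x * N + (B + 1)
  e₁ = solve-∀
  e₂ : ∀ x N A B → suc x * (N * A) + x * (B + 1) + (B + 1) ≡ suc x * (N * A + B) + suc x
  e₂ = solve-∀
  e₃ : ∀ x M A B → suc x * (A + M * B) + suc x ≡ suc x * (A + 1) + suc x * M * B
  e₃ = solve-∀

n≤m⇒n!*aₘ+aₙ≤aₘ+m!*aₙ : ∀ {m n} → 2 ≤ n → n ≤ m → n ! * a m + a n ≤ a m + m ! * a n
n≤m⇒n!*aₘ+aₙ≤aₘ+m!*aₙ {n = n} 2≤n n≤m = go (≤⇒≤′ n≤m)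
  where
  go : ∀ {m} → n ≤′ m → n ! * a m + a n ≤ a m + m ! * a n
  go ≤′-refl = ≤-reflexive (+-comm (n ! * a n) (a n))
  go (≤′-step n≤′m) = <⇒≤ (n!*aₘ₊₁+aₙ<aₘ₊₁+m!*aₙ 2≤n (≤′⇒≤ n≤′m) (go n≤′m))

n<m⇒n!*aₘ+aₙ<aₘ+m!*aₙ : ∀ {m n} → 2 ≤ n → n < m → n ! * a m + a n < a m + m ! * a n
n<m⇒n!*aₘ+aₙ<aₘ+m!*aₙ 2≤n (s≤s n≤m) =
  n!*aₘ₊₁+aₙ<aₘ₊₁+m!*aₙ 2≤n n≤m (n≤m⇒n!*aₘ+aₙ≤aₘ+m!*aₙ 2≤n n≤m)

fList : List (ℕ × ℕ) → ℕ
fList []       = 0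
fList (q ∷ qs) = f q qs

f≡ : ∀ n β qs → f (n , β) qs ≡ β * (a n + n ! * fList qs)
f≡ n β []       rewrite *-zeroʳ (n !) | +-identityʳ (a n) = refl
f≡ n β (q ∷ qs) = refl

f-swap-< : ∀ m n α β qs → α * a m + α * β * (m ! * a n) < β * a n + α * β * (n ! * a m) →
           f (m , α) ((n , β) ∷ qs) < f (n , β) ((m , α) ∷ qs)
f-swap-< m n α β qs lt = begin-strict
  α * (a m + m ! * f (n , β) qs)                ≡⟨ cong (λ x → α * (a m + m ! * x)) (f≡ n β qs) ⟩
  α * (a m + m ! * (β * (a n + n ! * T)))       ≡⟨ e₁ α β (a m) (a n) (m !) (n !) T ⟩
  α * a m + α * β * (m ! * a n) + shared        <⟨ +-monoˡ-< shared lt ⟩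
  β * a n + α * β * (n ! * a m) + shared        ≡⟨ e₂ α β (a m) (a n) (m !) (n !) T ⟩
  β * (a n + n ! * (α * (a m + m ! * T)))       ≡⟨ cong (λ x → β * (a n + n ! * x)) (f≡ m α qs) ⟨
  β * (a n + n ! * f (m , α) qs)                ∎
  where
  open ≤-Reasoning
  T = fList qs
  shared = α * β * (m ! * n !) * T
  e₁ : ∀ α β A B M N T → α * (A + M * (β * (B + N * T))) ≡ α * A + α * β * (M * B) + α * β * (M * N) * T
  e₁ = solve-∀
  e₂ : ∀ α β A B M N T → β * B + α * β * (N * A) + α * β * (M * N) * T ≡ β * (B + N * (α * (A + M * T)))
  e₂ = solve-∀

swap-<-if-β≥2 : ∀ {m n α β} → 2 ≤ n → n < m → 1 ≤ α → 2 ≤ β →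
                α * a m + α * β * (m ! * a n) < β * a n + α * β * (n ! * a m)
swap-<-if-β≥2 {m} {n} {α} {β} 2≤n n<m 1≤α 2≤β = begin
  suc (α * a m + X)                ≤⟨ +-monoˡ-≤ (α * a m + X) 1≤α ⟩
  α + (α * a m + X)                ≡⟨ e₁ α (a m) X ⟩
  α * (a m + 1) + X                ≤⟨ +-monoˡ-≤ X (*-monoʳ-≤ α (+-monoʳ-≤ (a m) (n≤1+n 1))) ⟩
  α * (a m + 2) + X                ≤⟨ +-monoˡ-≤ X (*-monoʳ-≤ α (aₘ+2≤2*m! (≤-trans 2≤n (<⇒≤ n<m)))) ⟩
  α * (2 * m !) + X                ≤⟨ +-monoˡ-≤ X (*-monoʳ-≤ α (*-monoˡ-≤ (m !) 2≤β)) ⟩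
  α * (β * m !) + X                ≡⟨ e₂ α β (m !) (a n) ⟩
  α * β * (m ! * (a n + 1))        ≤⟨ *-monoʳ-≤ (α * β) (n<m⇒m!*[aₙ+1]≤n!*aₘ (≤-trans (s≤s z≤n) 2≤n) n<m) ⟩
  α * β * (n ! * a m)              ≤⟨ m≤n+m _ (β * a n) ⟩
  β * a n + α * β * (n ! * a m)    ∎
  where
  open ≤-Reasoning
  X = α * β * (m ! * a n)
  e₁ : ∀ α A X → α + (α * A + X) ≡ α * (A + 1) + X
  e₁ = solve-∀
  e₂ : ∀ α β M B → α * (β * M) + α * β * (M * B) ≡ α * β * (M * (B + 1))
  e₂ = solve-∀

swap->-if-β≡1 : ∀ {m n α} → 2 ≤ n → n < m → 1 ≤ α → a n + α * (n ! * a m) < α * a m + α * (m ! * a n)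
swap->-if-β≡1 {m} {n} {α} 2≤n n<m 1≤α = begin
  suc (a n) + α * (n ! * a m)      ≤⟨ +-monoˡ-≤ (α * (n ! * a m)) (m≤n*m (suc (a n)) α {{>-nonZero 1≤α}}) ⟩
  α * suc (a n) + α * (n ! * a m)  ≡⟨ e₁ α (a m) (a n) (n !) ⟩
  α * suc (n ! * a m + a n)        ≤⟨ *-monoʳ-≤ α (n<m⇒n!*aₘ+aₙ<aₘ+m!*aₙ 2≤n n<m) ⟩
  α * (a m + m ! * a n)            ≡⟨ *-distribˡ-+ α (a m) (m ! * a n) ⟩
  α * a m + α * (m ! * a n)        ∎
  where
  open ≤-Reasoning
  e₁ : ∀ α A B N → α * suc B + α * (N * A) ≡ α * suc (N * A + B)
  e₁ = solve-∀

lemma9 : (m n α β : ℕ) → (rest : List (ℕ × ℕ)) → All ValidPair rest →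
         2 ≤ n → n < m → 1 ≤ α → 1 ≤ β →
         (2 ≤ β → f (m , α) ((n , β) ∷ rest) < f (n , β) ((m , α) ∷ rest))
         × (β ≡ 1 → f (m , α) ((n , β) ∷ rest) > f (n , β) ((m , α) ∷ rest))
lemma9 m n α β rest _ 2≤n n<m 1≤α _ = β≥2⇒< , β≡1⇒>
  where
  β≥2⇒< : 2 ≤ β → f (m , α) ((n , β) ∷ rest) < f (n , β) ((m , α) ∷ rest)
  β≥2⇒< 2≤β = f-swap-< m n α β rest (swap-<-if-β≥2 2≤n n<m 1≤α 2≤β)
  β≡1⇒> : β ≡ 1 → f (m , α) ((n , β) ∷ rest) > f (n , β) ((m , α) ∷ rest)
  β≡1⇒> refl = f-swap-< n m 1 α rest gt
    where
    gt : 1 * a n + 1 * α * (n ! * a m) < α * a m + 1 * α * (m ! * a n)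
    gt rewrite *-identityˡ (a n) | *-identityˡ α = swap->-if-β≡1 2≤n n<m 1≤α
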